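{- Let $n\ge 2$, let $p\ge n$ be a prime and let $q$ be a power of $p$. Let $1\le k\le n-1$ and let $x=(x_1,\dots,x_n)\in \mathbb{F}_q^n$ be non-zero. Then there exists a $k$-element subset $I\subseteq\{1,\dots,n\}$ with $\sum_{i\in I}x_i\ne 0$. -}

module Defs where

open import Level using (Level)
open import Data.Nat using (ℕ)
open import Data.Fin using (Fin; zero; suc)
open import Data.Fin.Subset using (Subset; inside; outside)
open import Data.Vec using ([]; _∷_)
open import Data.Product using (∃)
open import Relation.Nullary using (¬_)
open import Relation.Binary.PropositionalEquality using (setoid)
open import Function.Bundles using (Bijection)
open import Algebra.Bundles using (CommutativeRing)

IsField : ∀ {c ℓ} → CommutativeRing c ℓ → Set (c Level.⊔ ℓ)
IsField R = (¬ (0# ≈ 1#)) Data.Product.× (∀ x → ¬ (x ≈ 0#) → ∃ λ y → x * y ≈ 1#)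
  where open CommutativeRing R

HasCard : ∀ {c ℓ} → CommutativeRing c ℓ → ℕ → Set (c Level.⊔ ℓ)
HasCard R q = Bijection (setoid (Fin q)) (CommutativeRing.setoid R)

subsetSum : ∀ {c ℓ} (R : CommutativeRing c ℓ) {n : ℕ} →
            Subset n → (Fin n → CommutativeRing.Carrier R) → CommutativeRing.Carrier R
subsetSum R [] x = CommutativeRing.0# R
subsetSum R (inside ∷ I) x = CommutativeRing._+_ R (x zero) (subsetSum R I (λ i → x (suc i)))
subsetSum R (outside ∷ I) x = subsetSum R I (λ i → x (suc i))

{-# OPTIONS --safe #-}
module Submission where

-- If every k-element subset sum vanishes, then, as k < n, two k-subsets that differ
-- only in swapping x₀ for xᵢ show xᵢ = x₀; so all entries equal some a and k · a = 0.
-- Translation by a permutes the q elements of the additive group and so fixes their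
-- sum, whence q · a = 0. Since 1 ≤ k < p, k is coprime to q = pᵐ and Bézout gives a = 0.

open import Defs
open import Data.Nat using (ℕ; _≤_; _<_; _^_; zero; suc; s≤s; z≤n; _*_)
import Data.Nat as ℕ
open import Data.Nat.Primality using (Prime)
open import Data.Nat.Properties using (<⇒≤; <-≤-trans)
open import Data.Nat.Divisibility using (∣-trans)
open import Data.Nat.Coprimality as Coprime
  using (Coprime; coprime-Bézout; coprime-divisor; prime⇒coprime; 1-coprimeTo)
open import Data.Nat.GCD using (module Bézout)
open import Data.Fin using (Fin; zero; suc)
open import Data.Fin.Properties using (inj⇒≟)
open import Data.Fin.Subset using (Subset; ∣_∣; inside; outside; ⊥; _∉_)
open import Data.Fin.Subset.Properties using (∣⊥∣≡0; ∉⊥; drop-there; anySubset?)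
open import Data.Fin.Permutation using (Permutation; permutation)
open import Data.Vec using ([]; _∷_; _[_]≔_; here; there)
open import Data.Vec.Functional using (replicate)
open import Data.Product using (∃; _×_; _,_)
open import Function using (_∘_)
open import Function.Bundles using (Bijection; Inverse)
open import Function.Properties.Bijection using (Bijection⇒Inverse)
open import Function.Properties.Inverse using (Inverse⇒Injection)
import Function.Construct.Symmetry as Symmetry
open import Relation.Nullary using (¬_; yes; no; ¬?; contradiction)
open import Relation.Nullary.Decidable using (_×-dec_; decidable-stable)
open import Relation.Binary using (Setoid; Decidable)
open import Relation.Binary.PropositionalEquality as ≡ using (_≡_)
open import Algebra.Bundles using (CommutativeRing; AbelianGroup; Monoid)
import Algebra.Properties.Monoid.Mult as Mult
import Algebra.Properties.CommutativeMonoid.Sum as Sum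
import Algebra.Properties.Group as GroupProperties
import Algebra.Properties.CommutativeSemigroup as CommutativeSemigroupProperties

coprime-^ : ∀ {m n} → Coprime m n → ∀ e → Coprime m (n ^ e)
coprime-^ {m} _ zero = Coprime.sym (1-coprimeTo m)
coprime-^ {n = n} m⊥n (suc e) {d} (d∣m , d∣n*nᵉ) = coprime-^ m⊥n e (d∣m , coprime-divisor d⊥n d∣n*nᵉ)
  where
  d⊥n : Coprime d n
  d⊥n (c∣d , c∣n) = m⊥n (∣-trans c∣d d∣m , c∣n)

finite⇒≈-decidable : ∀ {a ℓ} {S : Setoid a ℓ} {q} →
                     Bijection (≡.setoid (Fin q)) S → Decidable (Setoid._≈_ S)
finite⇒≈-decidable bij = inj⇒≟ (Inverse⇒Injection (Symmetry.inverse (Bijection⇒Inverse bij)))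

module _ {a ℓ} (M : Monoid a ℓ) where
  open Monoid M
  open Mult M using (×-congʳ; ×-assocˡ) renaming (_×_ to infixr 8 _·_)
  open import Relation.Binary.Reasoning.Setoid setoid

  ·-zeroʳ : ∀ k → k · ε ≈ ε
  ·-zeroʳ zero    = refl
  ·-zeroʳ (suc k) = trans (∙-congˡ (·-zeroʳ k)) (identityʳ ε)

  ·≈ε-coprime⇒≈ε : ∀ {m n x} → Coprime m n → m · x ≈ ε → n · x ≈ ε → x ≈ ε
  ·≈ε-coprime⇒≈ε {m} {n} {x} m⊥n m·x≈ε n·x≈ε = fromBézout (coprime-Bézout m⊥n)
    where
    multiple-annihilates : ∀ {k} l → k · x ≈ ε → (l * k) · x ≈ ε
    multiple-annihilates {k} l k·x≈ε = begin
      (l * k) · x   ≈⟨ ×-assocˡ x l k ⟨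
      l · (k · x)   ≈⟨ ×-congʳ l k·x≈ε ⟩
      l · ε         ≈⟨ ·-zeroʳ l ⟩
      ε             ∎
    consecutive-annihilate : ∀ {s t} → suc s ≡ t → s · x ≈ ε → t · x ≈ ε → x ≈ ε
    consecutive-annihilate {s} ≡.refl s·x≈ε t·x≈ε = begin
      x             ≈⟨ identityʳ x ⟨
      x ∙ ε         ≈⟨ ∙-congˡ s·x≈ε ⟨
      suc s · x     ≈⟨ t·x≈ε ⟩
      ε             ∎
    fromBézout : Bézout.Identity 1 m n → x ≈ ε
    fromBézout (Bézout.+- i j eq) = consecutive-annihilate eq (multiple-annihilates j n·x≈ε) (multiple-annihilates i m·x≈ε)
    fromBézout (Bézout.-+ i j eq) = consecutive-annihilate eq (multiple-annihilates i m·x≈ε) (multiple-annihilates j n·x≈ε)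

module _ {a ℓ} (G : AbelianGroup a ℓ) where
  open AbelianGroup G
  open Mult monoid using () renaming (_×_ to infixr 8 _·_)
  open Sum commutativeMonoid using (sum; sum-permute; sum-cong-≋; ∑-distrib-+; sum-replicate)
  open GroupProperties group using (∙-cancelˡ)
  open import Relation.Binary.Reasoning.Setoid setoid

  finite-order-annihilates : ∀ {q} → Bijection (≡.setoid (Fin q)) setoid → ∀ x → q · x ≈ ε
  finite-order-annihilates {q} card x = ∙-cancelˡ (sum to) (q · x) ε (begin
    sum to ∙ q · x                       ≈⟨ ∙-congˡ (sum-replicate q) ⟨
    sum to ∙ sum (replicate q x)         ≈⟨ ∑-distrib-+ to (replicate q x) ⟨
    sum (λ i → to i ∙ x)                 ≈⟨ sum-cong-≋ (λ i → strictlyInverseˡ (to i ∙ x)) ⟨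
    sum (to ∘ translate x)               ≈⟨ sum-permute to translation ⟨
    sum to                               ≈⟨ identityʳ (sum to) ⟨
    sum to ∙ ε                           ∎)
    where
    open Inverse (Bijection⇒Inverse card) using (to; from; from-cong; strictlyInverseˡ; strictlyInverseʳ)

    translate : Carrier → Fin q → Fin q
    translate y i = from (to i ∙ y)

    translate-cancel : ∀ {y z} → y ∙ z ≈ ε → ∀ i → translate z (translate y i) ≡ i
    translate-cancel {y} {z} y∙z≈ε i = ≡.trans (from-cong (begin
      to (from (to i ∙ y)) ∙ z   ≈⟨ ∙-congʳ (strictlyInverseˡ (to i ∙ y)) ⟩
      (to i ∙ y) ∙ z             ≈⟨ assoc (to i) y z ⟩
      to i ∙ (y ∙ z)             ≈⟨ ∙-congˡ y∙z≈ε ⟩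
      to i ∙ ε                   ≈⟨ identityʳ (to i) ⟩
      to i                       ∎)) (strictlyInverseʳ i)

    translation : Permutation q q
    translation = permutation (translate x) (translate (x ⁻¹))
                    (translate-cancel (inverseˡ x)) (translate-cancel (inverseʳ x))

subset-of-size : ∀ {n r} → r ≤ n → ∃ λ (J : Subset n) → ∣ J ∣ ≡ r
subset-of-size {n} z≤n = ⊥ , ∣⊥∣≡0 n
subset-of-size (s≤s r≤n) with subset-of-size r≤n
... | J , ∣J∣≡r = inside ∷ J , ≡.cong suc ∣J∣≡r

subset-of-size-avoiding : ∀ {n r} → r < n → (i : Fin n) → ∃ λ (J : Subset n) → ∣ J ∣ ≡ r × i ∉ J
subset-of-size-avoiding (s≤s r≤n) zero with subset-of-size r≤n
... | J , ∣J∣≡r = outside ∷ J , ∣J∣≡r , λ ()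
subset-of-size-avoiding {suc n} {zero} _ (suc i) = ⊥ , ∣⊥∣≡0 (suc n) , ∉⊥
subset-of-size-avoiding {r = suc r} (s≤s r<n) (suc i) with subset-of-size-avoiding r<n i
... | J , ∣J∣≡r , i∉J = inside ∷ J , ≡.cong suc ∣J∣≡r , i∉J ∘ drop-there

∣p[i]≔inside∣≡1+∣p∣ : ∀ {n} (p : Subset n) {i} → i ∉ p → ∣ p [ i ]≔ inside ∣ ≡ suc ∣ p ∣
∣p[i]≔inside∣≡1+∣p∣ (outside ∷ p) {zero}  _   = ≡.refl
∣p[i]≔inside∣≡1+∣p∣ (inside  ∷ p) {zero}  i∉p = contradiction here i∉p
∣p[i]≔inside∣≡1+∣p∣ (outside ∷ p) {suc i} i∉p = ∣p[i]≔inside∣≡1+∣p∣ p (i∉p ∘ there)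
∣p[i]≔inside∣≡1+∣p∣ (inside  ∷ p) {suc i} i∉p = ≡.cong suc (∣p[i]≔inside∣≡1+∣p∣ p (i∉p ∘ there))

SubsetSumsVanish : ∀ {c ℓ} (R : CommutativeRing c ℓ) {n} → ℕ → (Fin n → CommutativeRing.Carrier R) → Set ℓ
SubsetSumsVanish R k x = ∀ I → ∣ I ∣ ≡ k → CommutativeRing._≈_ R (subsetSum R I x) (CommutativeRing.0# R)

module _ {c ℓ} (R : CommutativeRing c ℓ) where
  open CommutativeRing R hiding (zero)
  open CommutativeSemigroupProperties +-commutativeSemigroup using (x∙yz≈y∙xz)
  open Mult +-monoid using () renaming (_×_ to infixr 8 _·_)
  open GroupProperties +-group using (∙-cancelʳ)
  open import Relation.Binary.Reasoning.Setoid setoid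

  subsetSum-[]≔inside : ∀ {n} (p : Subset n) {i} (x : Fin n → Carrier) → i ∉ p →
                        subsetSum R (p [ i ]≔ inside) x ≈ x i + subsetSum R p x
  subsetSum-[]≔inside (outside ∷ p) {zero}  x _   = refl
  subsetSum-[]≔inside (inside  ∷ p) {zero}  x i∉p = contradiction here i∉p
  subsetSum-[]≔inside (outside ∷ p) {suc i} x i∉p = subsetSum-[]≔inside p (x ∘ suc) (i∉p ∘ there)
  subsetSum-[]≔inside (inside  ∷ p) {suc i} x i∉p = begin
    x zero + subsetSum R (p [ i ]≔ inside) (x ∘ suc)   ≈⟨ +-congˡ (subsetSum-[]≔inside p (x ∘ suc) (i∉p ∘ there)) ⟩
    x zero + (x (suc i) + subsetSum R p (x ∘ suc))     ≈⟨ x∙yz≈y∙xz (x zero) (x (suc i)) _ ⟩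
    x (suc i) + (x zero + subsetSum R p (x ∘ suc))     ∎

  subsetSum-constant : ∀ {n} (p : Subset n) {x : Fin n → Carrier} {a} → (∀ i → x i ≈ a) →
                       subsetSum R p x ≈ ∣ p ∣ · a
  subsetSum-constant []            x≈a = refl
  subsetSum-constant (inside  ∷ p) x≈a = +-cong (x≈a zero) (subsetSum-constant p (x≈a ∘ suc))
  subsetSum-constant (outside ∷ p) x≈a = subsetSum-constant p (x≈a ∘ suc)

  subsetSumsVanish⇒constant : ∀ {n k} → k < n → (x : Fin (suc n) → Carrier) →
                              SubsetSumsVanish R (suc k) x → ∀ i → x i ≈ x zero
  subsetSumsVanish⇒constant _   x vanish zero    = refl
  subsetSumsVanish⇒constant k<n x vanish (suc i) with subset-of-size-avoiding k<n i
  ... | J , ∣J∣≡k , i∉J = ∙-cancelʳ (subsetSum R J (x ∘ suc)) (x (suc i)) (x zero) (begin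
    x (suc i) + subsetSum R J (x ∘ suc)      ≈⟨ subsetSum-[]≔inside J (x ∘ suc) i∉J ⟨
    subsetSum R (outside ∷ (J [ i ]≔ inside)) x
      ≈⟨ vanish (outside ∷ (J [ i ]≔ inside)) (≡.trans (∣p[i]≔inside∣≡1+∣p∣ J i∉J) (≡.cong suc ∣J∣≡k)) ⟩
    0#                                       ≈⟨ vanish (inside ∷ J) (≡.cong suc ∣J∣≡k) ⟨
    x zero + subsetSum R J (x ∘ suc)         ∎)

  subsetSumsVanish⇒≈0 : ∀ {n k q} → k < n → Coprime (suc k) q → (∀ y → q · y ≈ 0#) →
                        (x : Fin (suc n) → Carrier) → SubsetSumsVanish R (suc k) x → ∀ i → x i ≈ 0#
  subsetSumsVanish⇒≈0 {k = k} {q} k<n k⊥q q·y≈0 x vanish i =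
    trans (x≈x₀ i) (·≈ε-coprime⇒≈ε +-monoid k⊥q k·x₀≈0 (q·y≈0 (x zero)))
    where
    x≈x₀ : ∀ i → x i ≈ x zero
    x≈x₀ = subsetSumsVanish⇒constant k<n x vanish

    k·x₀≈0 : suc k · x zero ≈ 0#
    k·x₀≈0 with subset-of-size (s≤s (<⇒≤ k<n))
    ... | J , ∣J∣≡k = begin
      suc k · x zero     ≡⟨ ≡.cong (_· x zero) ∣J∣≡k ⟨
      ∣ J ∣ · x zero     ≈⟨ subsetSum-constant J x≈x₀ ⟨
      subsetSum R J x    ≈⟨ vanish J ∣J∣≡k ⟩
      0#                 ∎

  nonvanishing-subsetSum : ∀ {n k} {x : Fin n → Carrier} → Decidable _≈_ → ¬ SubsetSumsVanish R k x →
                           ∃ λ (I : Subset n) → ∣ I ∣ ≡ k × ¬ (subsetSum R I x ≈ 0#)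
  nonvanishing-subsetSum {k = k} {x} _≟_ ¬vanish
    with anySubset? (λ I → (∣ I ∣ ℕ.≟ k) ×-dec ¬? (subsetSum R I x ≟ 0#))
  ... | yes found = found
  ... | no none   = contradiction vanish ¬vanish
    where
    vanish : SubsetSumsVanish R k x
    vanish I ∣I∣≡k = decidable-stable (subsetSum R I x ≟ 0#) (λ ≉0 → none (I , ∣I∣≡k , ≉0))

lemma5p2 : ∀ {c ℓ} (n p q : ℕ) → 2 ≤ n → Prime p → n ≤ p → (∃ λ m → 1 ≤ m × q ≡ p ^ m) →
           (F : CommutativeRing c ℓ) → IsField F → HasCard F q →
           (k : ℕ) → 1 ≤ k → k < n →
           (x : Fin n → CommutativeRing.Carrier F) →
           ¬ (∀ i → CommutativeRing._≈_ F (x i) (CommutativeRing.0# F)) →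
           ∃ λ (I : Subset n) → ∣ I ∣ ≡ k × ¬ (CommutativeRing._≈_ F (subsetSum F I x) (CommutativeRing.0# F))
lemma5p2 (suc n) p q _ p-prime n≤p (m , _ , ≡.refl) F _ card (suc k) _ (s≤s k<n) x x≉0 =
  nonvanishing-subsetSum F (finite⇒≈-decidable card)
    (x≉0 ∘ subsetSumsVanish⇒≈0 F k<n k⊥q (finite-order-annihilates (CommutativeRing.+-abelianGroup F) card) x)
  where
  k⊥q : Coprime (suc k) (p ^ m)
  k⊥q = coprime-^ (Coprime.sym (prime⇒coprime p-prime (<-≤-trans (s≤s k<n) n≤p))) m
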